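{- Let $n\ge 11$ and $1\le d\le n-1$ be integers and let $\lambda=(\lambda_1,\dots,\lambda_t)\in\mathbb U^*_{T_{n,d}}$, where $T_{n,d}=\frac{n(n+1)}{2}-d$, be such that $d$ is not a part of $\lambda$. If $\lambda_t=2n-4$, then $d=n-5$, and there is exactly one such partition.
   Context: A partition of $N$ into distinct parts is a sequence of positive integers $\lambda_1<\dots<\lambda_t$ summing to $N$ with $t\ge 2$. Its missing parts are the elements of $\{1,\dots,\lambda_t\}\setminus\{\lambda_1,\dots,\lambda_t\}$. $\lambda$ is refinable if two distinct missing parts sum to a part of $\lambda$, unrefinable otherwise; $\mathbb U_N$ is the set of unrefinable partitions of $N$. $\mathbb U^*_N$ is the set of $\lambda\in\mathbb U_N$ whose largest part is the maximum of the largest parts over all of $\mathbb U_N$. Standing assumption: $n\ge 11$. -}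

module Defs where

open import Data.Nat using (ℕ; _+_; _*_; _∸_; _≤_; _<_; _⊔_; zero; suc)
open import Data.Nat.DivMod using (_/_)
open import Data.List using (List; length; foldr)
open import Data.Nat.ListAction using (sum)
open import Data.List.Relation.Unary.All using (All)
open import Data.List.Relation.Unary.Linked using (Linked)
open import Data.List.Membership.Propositional using (_∈_; _∉_)
open import Data.Product using (Σ; _×_; ∃)
open import Relation.Binary.PropositionalEquality using (_≡_; _≢_)
open import Relation.Nullary using (¬_)

record DistinctPartition (N : ℕ) (λs : List ℕ) : Set where
  field
    increasing : Linked _<_ λs
    positive   : All (λ x → 0 < x) λs
    atLeastTwo : 2 ≤ length λs
    sums       : sum λs ≡ N

-- largest part (equals the last entry λₜ of an increasing list)
largest : List ℕ → ℕ
largest = foldr _⊔_ 0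

Missing : List ℕ → ℕ → Set
Missing λs m = (1 ≤ m) × (m ≤ largest λs) × (m ∉ λs)

Refinable : List ℕ → Set
Refinable λs = Σ ℕ λ a → Σ ℕ λ b →
  Missing λs a × Missing λs b × a ≢ b × (a + b) ∈ λs

InU : ℕ → List ℕ → Set
InU N λs = DistinctPartition N λs × ¬ Refinable λs

InUStar : ℕ → List ℕ → Set
InUStar N λs = InU N λs × (∀ μ → InU N μ → largest μ ≤ largest λs)

T : ℕ → ℕ → ℕ
T n d = (n * (n + 1)) / 2 ∸ d

Cond : ℕ → ℕ → List ℕ → Set
Cond n d λs = InUStar (T n d) λs × d ∉ λs × largest λs ≡ 2 * n ∸ 4

{-# OPTIONS --safe #-}
-- Write n = K + 3, so that the largest part is L = 2K + 2. As L is a part and λ is unrefinable, for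
-- every a ≤ K at least one of a, L − a is a part, so the pair contributes a + e(a) to the sum of λ,
-- where the excess e(a) is 0 (only a), L − 2a (only L − a) or L − a (both). Comparing the sum with
-- T + d = 1 + ⋯ + n gives  ∑ e(a) + [K + 1 ∈ λ](K + 1) + d = K + 4.  Every excess is 0, 2 (only for
-- a = K) or at least 4, which leaves no room for d ∈ {K + 1, K + 2}; for d ≤ K the missing part d
-- forces e(d) = L − 2d, all other excesses vanish, d = K − 2, and λ = {1,…,K} ∖ {d} ∪ {K + 4, L}.
module Submission where

open import Defs
open import Data.Bool using (if_then_else_)
open import Data.Nat
open import Data.Nat.DivMod using (_/_; m*n/n≡m)
open import Data.Nat.ListAction using (sum)
open import Data.Nat.Properties
open import Data.Nat.Tactic.RingSolver using (solve-∀)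
open import Data.List using (List; []; _∷_; [_])
open import Data.List.Membership.DecPropositional _≟_ using (_∈?_)
open import Data.List.Membership.Propositional using (_∈_; _∉_)
open import Data.List.Membership.Propositional.Properties using (foldr-selective)
open import Data.List.Properties using (foldr-forcesᵇ)
open import Data.List.Relation.Unary.All as All using (All; []; _∷_)
import Data.List.Relation.Unary.AllPairs as AllPairs
open import Data.List.Relation.Unary.Any using (here; there)
open import Data.List.Relation.Unary.Linked as Linked using (Linked)
open import Data.List.Relation.Unary.Linked.Properties using (Linked⇒AllPairs)
open import Data.List.Relation.Unary.Unique.Propositional using (Unique)
open import Data.List.Relation.Unary.Unique.Propositional.Properties using (Unique[x∷xs]⇒x∉xs)
open import Data.Product using (_×_; _,_; proj₁; proj₂)
open import Data.Sum using (_⊎_; inj₁; inj₂; reduce)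
open import Function using (id; _∘_; _⇔_; mk⇔; Equivalence)
open import Relation.Nullary using (¬_; Dec; yes; no; does; contradiction)
open import Relation.Binary.PropositionalEquality
  using (_≡_; _≢_; refl; sym; trans; cong; cong₂; subst; module ≡-Reasoning)

∑ : ℕ → ℕ → (ℕ → ℕ) → ℕ
∑ s zero    f = 0
∑ s (suc m) f = f s + ∑ (suc s) m f

AllFrom : ℕ → ℕ → (ℕ → Set) → Set
AllFrom s m P = ∀ x → s ≤ x → x < s + m → P x

private
  <suc+⇒<+suc : ∀ {s m x} → x < suc s + m → x < s + suc m
  <suc+⇒<+suc {s} {m} {x} = subst (x <_) (sym (+-suc s m))

  <+suc⇒<suc+ : ∀ {s m x} → x < s + suc m → x < suc s + m
  <+suc⇒<suc+ {s} {m} {x} = subst (x <_) (+-suc s m)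

  empty-range : ∀ {s x} → s ≤ x → x < s + 0 → ∀ {A : Set} → A
  empty-range {s} s≤x x<s+0 = contradiction (subst (_ <_) (+-identityʳ s) x<s+0) (≤⇒≯ s≤x)

  AllFrom-head : ∀ {s m P} → AllFrom s (suc m) P → P s
  AllFrom-head {s} {m} all = all s ≤-refl (m<m+n s z<s)

  AllFrom-tail : ∀ {s m P} → AllFrom s (suc m) P → AllFrom (suc s) m P
  AllFrom-tail all x s<x x<end = all x (<⇒≤ s<x) (<suc+⇒<+suc x<end)

∑-cong : ∀ s m {f g} → AllFrom s m (λ x → f x ≡ g x) → ∑ s m f ≡ ∑ s m g
∑-cong s zero    eq = refl
∑-cong s (suc m) eq = cong₂ _+_ (AllFrom-head eq) (∑-cong (suc s) m (AllFrom-tail eq))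

∑-zero : ∀ s m {f} → AllFrom s m (λ x → f x ≡ 0) → ∑ s m f ≡ 0
∑-zero s zero    eq = refl
∑-zero s (suc m) eq = cong₂ _+_ (AllFrom-head eq) (∑-zero (suc s) m (AllFrom-tail eq))

∑-+ : ∀ s m f g → ∑ s m (λ x → f x + g x) ≡ ∑ s m f + ∑ s m g
∑-+ s zero    f g = refl
∑-+ s (suc m) f g = begin
  f s + g s + ∑ (suc s) m (λ x → f x + g x)      ≡⟨ cong (f s + g s +_) (∑-+ (suc s) m f g) ⟩
  f s + g s + (∑ (suc s) m f + ∑ (suc s) m g)    ≡⟨ interchange (f s) (g s) _ _ ⟩
  f s + ∑ (suc s) m f + (g s + ∑ (suc s) m g)    ∎
  where
  open ≡-Reasoning
  interchange : ∀ a b c d → a + b + (c + d) ≡ a + c + (b + d)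
  interchange = solve-∀

∑-split : ∀ s m k f → ∑ s (m + k) f ≡ ∑ s m f + ∑ (s + m) k f
∑-split s zero    k f = cong (λ t → ∑ t k f) (sym (+-identityʳ s))
∑-split s (suc m) k f = begin
  f s + ∑ (suc s) (m + k) f                   ≡⟨ cong (f s +_) (∑-split (suc s) m k f) ⟩
  f s + (∑ (suc s) m f + ∑ (suc s + m) k f)   ≡⟨ sym (+-assoc (f s) _ _) ⟩
  f s + ∑ (suc s) m f + ∑ (suc s + m) k f     ≡⟨ cong (λ t → f s + ∑ (suc s) m f + ∑ t k f) (sym (+-suc s m)) ⟩
  f s + ∑ (suc s) m f + ∑ (s + suc m) k f     ∎
  where open ≡-Reasoning

∑-snoc : ∀ s m f → ∑ s (suc m) f ≡ ∑ s m f + f (s + m)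
∑-snoc s m f = begin
  ∑ s (suc m) f                  ≡⟨ cong (λ k → ∑ s k f) (+-comm 1 m) ⟩
  ∑ s (m + 1) f                  ≡⟨ ∑-split s m 1 f ⟩
  ∑ s m f + (f (s + m) + 0)      ≡⟨ cong (∑ s m f +_) (+-identityʳ _) ⟩
  ∑ s m f + f (s + m)            ∎
  where open ≡-Reasoning

∑-reflect : ∀ {c} s t m f → suc c ≡ s + t + m → ∑ s m (λ a → f (c ∸ a)) ≡ ∑ t m f
∑-reflect         s t zero    f _  = refl
∑-reflect {c} s t (suc m) f eq = begin
  f (c ∸ s) + ∑ (suc s) m (λ a → f (c ∸ a))   ≡⟨ cong₂ _+_ (cong f c∸s≡t+m) (∑-reflect (suc s) t m f eq′) ⟩
  f (t + m) + ∑ t m f                         ≡⟨ +-comm (f (t + m)) _ ⟩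
  ∑ t m f + f (t + m)                         ≡⟨ sym (∑-snoc t m f) ⟩
  ∑ t (suc m) f                               ∎
  where
  open ≡-Reasoning
  eq′ : suc c ≡ suc s + t + m
  eq′ = trans eq (+-suc (s + t) m)
  c∸s≡t+m : c ∸ s ≡ t + m
  c∸s≡t+m = trans (cong (_∸ s) (suc-injective (trans eq′ (cong suc (+-assoc s t m))))) (m+n∸m≡n s (t + m))

term≤∑ : ∀ s m f {j} → s ≤ j → j < s + m → f j ≤ ∑ s m f
term≤∑ s zero    f s≤j j<end = empty-range s≤j j<end
term≤∑ s (suc m) f {j} s≤j j<end with s ≟ j
... | yes refl = m≤m+n (f s) _
... | no s≢j   = ≤-trans (term≤∑ (suc s) m f (≤∧≢⇒< s≤j s≢j) (<+suc⇒<suc+ j<end)) (m≤n+m _ (f s))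

twoTerms≤∑ : ∀ s m f {j k} → s ≤ j → j < s + m → s ≤ k → k < s + m → j ≢ k → f j + f k ≤ ∑ s m f
twoTerms≤∑ s zero    f s≤j j<end _ _ _ = empty-range s≤j j<end
twoTerms≤∑ s (suc m) f {j} {k} s≤j j<end s≤k k<end j≢k with s ≟ j | s ≟ k
... | yes refl | _        = +-monoʳ-≤ (f s) (term≤∑ (suc s) m f (≤∧≢⇒< s≤k j≢k) (<+suc⇒<suc+ k<end))
... | no _     | yes refl = subst (_≤ ∑ s (suc m) f) (+-comm (f s) (f j))
                              (+-monoʳ-≤ (f s) (term≤∑ (suc s) m f (≤∧≢⇒< s≤j (j≢k ∘ sym)) (<+suc⇒<suc+ j<end)))
... | no s≢j   | no s≢k   = ≤-trans
  (twoTerms≤∑ (suc s) m f (≤∧≢⇒< s≤j s≢j) (<+suc⇒<suc+ j<end) (≤∧≢⇒< s≤k s≢k) (<+suc⇒<suc+ k<end) j≢k)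
  (m≤n+m _ (f s))

∑-single : ∀ s m f {j} → s ≤ j → j < s + m → AllFrom s m (λ x → x ≢ j → f x ≡ 0) → ∑ s m f ≡ f j
∑-single s zero    f s≤j j<end _ = empty-range s≤j j<end
∑-single s (suc m) f {j} s≤j j<end vanish with s ≟ j
... | yes refl = trans (cong (f s +_) (∑-zero (suc s) m (λ x s<x x<end → AllFrom-tail vanish x s<x x<end (<⇒≢ s<x ∘ sym)))) (+-identityʳ (f s))
... | no s≢j   = trans (cong (_+ ∑ (suc s) m f) (AllFrom-head vanish s≢j))
                       (∑-single (suc s) m f (≤∧≢⇒< s≤j s≢j) (<+suc⇒<suc+ j<end) (AllFrom-tail vanish))

∑-id*2 : ∀ n → ∑ 0 (suc n) id * 2 ≡ n * (n + 1)
∑-id*2 zero    = refl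
∑-id*2 (suc n) = begin
  ∑ 0 (suc (suc n)) id * 2              ≡⟨ cong (_* 2) (∑-snoc 0 (suc n) id) ⟩
  (∑ 0 (suc n) id + suc n) * 2          ≡⟨ *-distribʳ-+ 2 (∑ 0 (suc n) id) (suc n) ⟩
  ∑ 0 (suc n) id * 2 + suc n * 2        ≡⟨ cong (_+ suc n * 2) (∑-id*2 n) ⟩
  n * (n + 1) + suc n * 2               ≡⟨ step n ⟩
  suc n * (suc n + 1)                   ∎
  where
  open ≡-Reasoning
  step : ∀ n → n * (n + 1) + suc n * 2 ≡ suc n * (suc n + 1)
  step = solve-∀

∑-pairs : ∀ K f → ∑ 0 (3 + (K + K)) f ≡
  f 0 + ∑ 1 K (λ a → f a + f (2 + (K + K) ∸ a)) + f (suc K) + f (2 + (K + K))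
∑-pairs K f = begin
  ∑ 0 (3 + (K + K)) f
    ≡⟨ cong (λ m → ∑ 0 m f) (length≡ K) ⟩
  f 0 + ∑ 1 (K + suc (suc K)) f
    ≡⟨ cong (f 0 +_) (∑-split 1 K (suc (suc K)) f) ⟩
  f 0 + (∑ 1 K f + (f (suc K) + ∑ (2 + K) (suc K) f))
    ≡⟨ cong (λ t → f 0 + (∑ 1 K f + (f (suc K) + t))) (∑-snoc (2 + K) K f) ⟩
  f 0 + (∑ 1 K f + (f (suc K) + (∑ (2 + K) K f + f (2 + (K + K)))))
    ≡⟨ regroup (f 0) (∑ 1 K f) (f (suc K)) (∑ (2 + K) K f) (f (2 + (K + K))) ⟩
  f 0 + (∑ 1 K f + ∑ (2 + K) K f) + f (suc K) + f (2 + (K + K))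
    ≡⟨ cong (λ t → f 0 + t + f (suc K) + f (2 + (K + K))) paired ⟩
  f 0 + ∑ 1 K (λ a → f a + f (2 + (K + K) ∸ a)) + f (suc K) + f (2 + (K + K))
    ∎
  where
  open ≡-Reasoning
  length≡ : ∀ K → 3 + (K + K) ≡ 1 + (K + (2 + K))
  length≡ = solve-∀
  regroup : ∀ a b c d e → a + (b + (c + (d + e))) ≡ a + (b + d) + c + e
  regroup = solve-∀
  paired : ∑ 1 K f + ∑ (2 + K) K f ≡ ∑ 1 K (λ a → f a + f (2 + (K + K) ∸ a))
  paired = sym (trans (∑-+ 1 K f _) (cong (∑ 1 K f +_) (∑-reflect 1 (2 + K) K f refl)))

partAt : List ℕ → ℕ → ℕ
partAt xs x = if does (x ∈? xs) then x else 0

partAt-∈ : ∀ {xs x} → x ∈ xs → partAt xs x ≡ x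
partAt-∈ {xs} {x} x∈xs with x ∈? xs
... | yes _   = refl
... | no x∉xs = contradiction x∈xs x∉xs

partAt-∉ : ∀ {xs x} → x ∉ xs → partAt xs x ≡ 0
partAt-∉ {xs} {x} x∉xs with x ∈? xs
... | yes x∈xs = contradiction x∈xs x∉xs
... | no _     = refl

partAt-cases : ∀ xs x → partAt xs x ≡ 0 ⊎ partAt xs x ≡ x
partAt-cases xs x with x ∈? xs
... | yes _ = inj₂ refl
... | no _  = inj₁ refl

partAt-zero : ∀ xs → partAt xs 0 ≡ 0
partAt-zero xs = reduce (partAt-cases xs 0)

partAt-∷ : ∀ {y ys} x → y ∉ ys → partAt (y ∷ ys) x ≡ partAt [ y ] x + partAt ys x
partAt-∷ {y} {ys} x y∉ys with x ≟ y
... | yes refl = begin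
  partAt (x ∷ ys) x          ≡⟨ partAt-∈ {x ∷ ys} (here refl) ⟩
  x                          ≡⟨ sym (+-identityʳ x) ⟩
  x + 0                      ≡⟨ sym (cong₂ _+_ (partAt-∈ {[ x ]} (here refl)) (partAt-∉ y∉ys)) ⟩
  partAt [ x ] x + partAt ys x ∎
  where open ≡-Reasoning
... | no x≢y = byMembership (x ∈? ys)
  where
  x∉[y] : x ∉ [ y ]
  x∉[y] (here x≡y) = x≢y x≡y
  byMembership : Dec (x ∈ ys) → partAt (y ∷ ys) x ≡ partAt [ y ] x + partAt ys x
  byMembership (yes x∈ys) = trans (partAt-∈ (there x∈ys)) (sym (cong₂ _+_ (partAt-∉ x∉[y]) (partAt-∈ x∈ys)))
  byMembership (no x∉ys)  = trans (partAt-∉ x∉y∷ys) (sym (cong₂ _+_ (partAt-∉ x∉[y]) (partAt-∉ x∉ys)))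
    where
    x∉y∷ys : x ∉ y ∷ ys
    x∉y∷ys (here x≡y)   = x≢y x≡y
    x∉y∷ys (there x∈ys) = x∉ys x∈ys

∑-partAt-single : ∀ {M y} → y ≤ M → ∑ 0 (suc M) (partAt [ y ]) ≡ y
∑-partAt-single {M} {y} y≤M = trans
  (∑-single 0 (suc M) (partAt [ y ]) z≤n (s≤s y≤M) (λ x _ _ x≢y → partAt-∉ {[ y ]} λ { (here x≡y) → x≢y x≡y }))
  (partAt-∈ {[ y ]} (here refl))

sum≡∑partAt : ∀ M {xs} → Unique xs → All (_≤ M) xs → sum xs ≡ ∑ 0 (suc M) (partAt xs)
sum≡∑partAt M {[]}     _   []           = sym (∑-zero 0 (suc M) {partAt []} (λ x _ _ → partAt-∉ {[]} {x} λ ()))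
sum≡∑partAt M {y ∷ ys} uniq (y≤M ∷ ys≤M) = begin
  y + sum ys
    ≡⟨ cong₂ _+_ (sym (∑-partAt-single y≤M)) (sum≡∑partAt M (AllPairs.tail uniq) ys≤M) ⟩
  ∑ 0 (suc M) (partAt [ y ]) + ∑ 0 (suc M) (partAt ys)
    ≡⟨ sym (∑-+ 0 (suc M) (partAt [ y ]) (partAt ys)) ⟩
  ∑ 0 (suc M) (λ x → partAt [ y ] x + partAt ys x)
    ≡⟨ ∑-cong 0 (suc M) (λ x _ _ → sym (partAt-∷ x (Unique[x∷xs]⇒x∉xs uniq))) ⟩
  ∑ 0 (suc M) (partAt (y ∷ ys))
    ∎
  where open ≡-Reasoning

parts≤largest : ∀ xs → All (_≤ largest xs) xs
parts≤largest xs = foldr-forcesᵇ (λ x y x⊔y≤ → m⊔n≤o⇒m≤o x y x⊔y≤ , m⊔n≤o⇒n≤o x y x⊔y≤) 0 xs ≤-refl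

largest∈ : ∀ xs → largest xs ≢ 0 → largest xs ∈ xs
largest∈ xs largest≢0 with foldr-selective ⊔-sel 0 xs
... | inj₁ largest≡0 = contradiction largest≡0 largest≢0
... | inj₂ largest∈xs = largest∈xs

increasing-ext : ∀ {xs ys} → Linked _<_ xs → Linked _<_ ys →
  (∀ z → z ∈ xs → z ∈ ys) → (∀ z → z ∈ ys → z ∈ xs) → xs ≡ ys
increasing-ext {[]}     {[]}     _ _ _ _ = refl
increasing-ext {[]}     {y ∷ _}  _ _ _ ys⊆xs with () ← ys⊆xs y (here refl)
increasing-ext {x ∷ _}  {[]}     _ _ xs⊆ys _ with () ← xs⊆ys x (here refl)
increasing-ext {x ∷ xs} {y ∷ ys} x↗ y↗ xs⊆ys ys⊆xs =
  cong₂ _∷_ x≡y (increasing-ext (Linked.tail x↗) (Linked.tail y↗) (shrink x≡y xs⊆ys x<xs) (shrink (sym x≡y) ys⊆xs y<ys))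
  where
  x<xs : All (x <_) xs
  x<xs = AllPairs.head (Linked⇒AllPairs <-trans x↗)
  y<ys : All (y <_) ys
  y<ys = AllPairs.head (Linked⇒AllPairs <-trans y↗)
  head≤ : ∀ {u us v} → All (u <_) us → v ∈ u ∷ us → u ≤ v
  head≤ _    (here refl)  = ≤-refl
  head≤ u<us (there v∈us) = <⇒≤ (All.lookup u<us v∈us)
  x≡y : x ≡ y
  x≡y = ≤-antisym (head≤ x<xs (ys⊆xs y (here refl))) (head≤ y<ys (xs⊆ys x (here refl)))
  shrink : ∀ {u us v vs} → u ≡ v → (∀ z → z ∈ u ∷ us → z ∈ v ∷ vs) → All (u <_) us → ∀ z → z ∈ us → z ∈ vs
  shrink u≡v us⊆ u<us z z∈us with us⊆ z (there z∈us)
  ... | here refl   = contradiction u≡v (<⇒≢ (All.lookup u<us z∈us))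
  ... | there z∈vs = z∈vs

ExtremalPart : ℕ → ℕ → ℕ → Set
ExtremalPart K d x = (1 ≤ x × x ≤ K × x ≢ d) ⊎ x ≡ 4 + K ⊎ x ≡ 2 + (K + K)

module LargestPart2K+2
  (K : ℕ) (2≤K : 2 ≤ K) {λs : List ℕ}
  (increasing : Linked _<_ λs) (unrefinable : ¬ Refinable λs)
  (largest≡L : largest λs ≡ 2 + (K + K)) where

  L : ℕ
  L = 2 + (K + K)

  h : ℕ → ℕ
  h = partAt λs

  excess : ℕ → ℕ
  excess a = h a + h (L ∸ a) ∸ a

  L∈λs : L ∈ λs
  L∈λs = subst (_∈ λs) largest≡L (largest∈ λs (subst (_≢ 0) (sym largest≡L) λ ()))

  parts≤L : All (_≤ L) λs
  parts≤L = subst (λ m → All (_≤ m) λs) largest≡L (parts≤largest λs)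

  L∸K≡2+K : L ∸ K ≡ 2 + K
  L∸K≡2+K = trans (cong (_∸ K) (L≡ K)) (m+n∸m≡n K (2 + K))
    where
    L≡ : ∀ K → 2 + (K + K) ≡ K + (2 + K)
    L≡ = solve-∀

  2+K≤L∸a : ∀ {a} → a ≤ K → 2 + K ≤ L ∸ a
  2+K≤L∸a {a} a≤K = subst (_≤ L ∸ a) L∸K≡2+K (∸-monoʳ-≤ L a≤K)

  a<L∸a : ∀ {a} → a ≤ K → a < L ∸ a
  a<L∸a a≤K = ≤-trans (s≤s (≤-trans a≤K (n≤1+n K))) (2+K≤L∸a a≤K)

  a≤L : ∀ {a} → a ≤ K → a ≤ L
  a≤L {a} a≤K = ≤-trans (<⇒≤ (a<L∸a a≤K)) (m∸n≤m L a)

  data PairView (a : ℕ) : Set where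
    onlySmall : a ∈ λs → L ∸ a ∉ λs → PairView a
    onlyLarge : a ∉ λs → L ∸ a ∈ λs → PairView a
    both      : a ∈ λs → L ∸ a ∈ λs → PairView a

  pairView : ∀ {a} → 1 ≤ a → a ≤ K → PairView a
  pairView {a} 1≤a a≤K with a ∈? λs | L ∸ a ∈? λs
  ... | yes a∈λs | yes b∈λs = both a∈λs b∈λs
  ... | yes a∈λs | no  b∉λs = onlySmall a∈λs b∉λs
  ... | no  a∉λs | yes b∈λs = onlyLarge a∉λs b∈λs
  ... | no  a∉λs | no  b∉λs = contradiction
    (a , L ∸ a , (1≤a , ≤largest (a≤L a≤K) , a∉λs) , (1≤L∸a , ≤largest (m∸n≤m L a) , b∉λs) ,
     <⇒≢ (a<L∸a a≤K) , subst (_∈ λs) (sym (m+[n∸m]≡n (a≤L a≤K))) L∈λs)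
    unrefinable
    where
    ≤largest : ∀ {x} → x ≤ L → x ≤ largest λs
    ≤largest {x} = subst (x ≤_) (sym largest≡L)
    1≤L∸a : 1 ≤ L ∸ a
    1≤L∸a = ≤-trans (s≤s z≤n) (2+K≤L∸a a≤K)

  excess-onlySmall : ∀ {a} → a ∈ λs → L ∸ a ∉ λs → excess a ≡ 0
  excess-onlySmall {a} a∈λs b∉λs =
    trans (cong₂ (λ u v → u + v ∸ a) (partAt-∈ a∈λs) (partAt-∉ b∉λs)) (m+n∸m≡n a 0)

  excess-both : ∀ {a} → a ∈ λs → L ∸ a ∈ λs → excess a ≡ L ∸ a
  excess-both {a} a∈λs b∈λs =
    trans (cong₂ (λ u v → u + v ∸ a) (partAt-∈ a∈λs) (partAt-∈ b∈λs)) (m+n∸m≡n a (L ∸ a))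

  excess-onlyLarge : ∀ {a} → a ≤ K → a ∉ λs → L ∸ a ∈ λs → excess a + a + a ≡ L
  excess-onlyLarge {a} a≤K a∉λs b∈λs = begin
    excess a + a + a       ≡⟨ cong (λ t → t + a + a) (cong₂ (λ u v → u + v ∸ a) (partAt-∉ a∉λs) (partAt-∈ b∈λs)) ⟩
    L ∸ a ∸ a + a + a      ≡⟨ cong (_+ a) (m∸n+n≡m (<⇒≤ (a<L∸a a≤K))) ⟩
    L ∸ a + a              ≡⟨ m∸n+n≡m (a≤L a≤K) ⟩
    L                      ∎
    where open ≡-Reasoning

  pairWeight≡ : ∀ {a} → 1 ≤ a → a ≤ K → h a + h (L ∸ a) ≡ a + excess a
  pairWeight≡ {a} 1≤a a≤K = sym (m+[n∸m]≡n a≤pairWeight)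
    where
    a≤pairWeight : a ≤ h a + h (L ∸ a)
    a≤pairWeight with pairView 1≤a a≤K
    ... | onlySmall a∈λs _ = subst (λ u → a ≤ u + h (L ∸ a)) (sym (partAt-∈ a∈λs)) (m≤m+n a _)
    ... | both      a∈λs _ = subst (λ u → a ≤ u + h (L ∸ a)) (sym (partAt-∈ a∈λs)) (m≤m+n a _)
    ... | onlyLarge _ b∈λs = subst (λ v → a ≤ h a + v) (sym (partAt-∈ b∈λs)) (≤-trans (<⇒≤ (a<L∸a a≤K)) (m≤n+m _ _))

  excess-cases : ∀ {a} → 1 ≤ a → a ≤ K → excess a ≡ 0 ⊎ (a ≡ K × excess a ≡ 2) ⊎ 4 ≤ excess a
  excess-cases {a} 1≤a a≤K with pairView 1≤a a≤K
  ... | onlySmall a∈λs b∉λs = inj₁ (excess-onlySmall a∈λs b∉λs)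
  ... | both a∈λs b∈λs =
    inj₂ (inj₂ (subst (4 ≤_) (sym (excess-both a∈λs b∈λs)) (≤-trans (+-monoʳ-≤ 2 2≤K) (2+K≤L∸a a≤K))))
  ... | onlyLarge a∉λs b∈λs with m≤n⇒m<n∨m≡n a≤K
  ...   | inj₂ refl = inj₂ (inj₁ (refl , +-cancelʳ-≡ (a + a) (excess a) 2 (trans (sym (+-assoc (excess a) a a)) (excess-onlyLarge a≤K a∉λs b∈λs))))
  ...   | inj₁ a<K  = inj₂ (inj₂ (+-cancelʳ-≤ (a + a) 4 (excess a) (begin
    4 + (a + a)         ≡⟨ +-suc-suc a ⟩
    2 + (suc a + suc a) ≤⟨ +-monoʳ-≤ 2 (+-mono-≤ a<K a<K) ⟩
    L                   ≡⟨ sym (excess-onlyLarge a≤K a∉λs b∈λs) ⟩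
    excess a + a + a    ≡⟨ +-assoc (excess a) a a ⟩
    excess a + (a + a)  ∎)))
    where
    open ≤-Reasoning
    +-suc-suc : ∀ a → 4 + (a + a) ≡ 2 + (suc a + suc a)
    +-suc-suc = solve-∀

  excess≡0⇒onlySmall : ∀ {a} → 1 ≤ a → a ≤ K → excess a ≡ 0 → a ∈ λs × L ∸ a ∉ λs
  excess≡0⇒onlySmall {a} 1≤a a≤K excess≡0 with pairView 1≤a a≤K
  ... | onlySmall a∈λs b∉λs = a∈λs , b∉λs
  ... | onlyLarge a∉λs b∈λs = contradiction
    (trans (cong (λ e → e + a + a) (sym excess≡0)) (excess-onlyLarge a≤K a∉λs b∈λs))
    (<⇒≢ (s≤s (≤-trans (+-mono-≤ a≤K a≤K) (n≤1+n (K + K)))))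
  ... | both a∈λs b∈λs = contradiction
    (trans (sym (excess-both a∈λs b∈λs)) excess≡0)
    (<⇒≢ (≤-trans (s≤s z≤n) (2+K≤L∸a a≤K)) ∘ sym)

  midPart≤2⇒≡0 : h (suc K) ≤ 2 → h (suc K) ≡ 0
  midPart≤2⇒≡0 mid≤2 with partAt-cases λs (suc K)
  ... | inj₁ mid≡0 = mid≡0
  ... | inj₂ mid≡1+K = contradiction (subst (_≤ 2) mid≡1+K mid≤2) (<⇒≱ (s≤s 2≤K))

  E : ℕ
  E = ∑ 1 K excess

  sum-λs : sum λs ≡ ∑ 1 K id + E + h (suc K) + L
  sum-λs = begin
    sum λs
      ≡⟨ sum≡∑partAt L (AllPairs.map <⇒≢ (Linked⇒AllPairs <-trans increasing)) parts≤L ⟩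
    ∑ 0 (suc L) h
      ≡⟨ ∑-pairs K h ⟩
    h 0 + ∑ 1 K (λ a → h a + h (L ∸ a)) + h (suc K) + h L
      ≡⟨ cong (λ t → t + ∑ 1 K (λ a → h a + h (L ∸ a)) + h (suc K) + h L) (partAt-zero λs) ⟩
    ∑ 1 K (λ a → h a + h (L ∸ a)) + h (suc K) + h L
      ≡⟨ cong (λ t → t + h (suc K) + h L) pairs≡ ⟩
    ∑ 1 K id + E + h (suc K) + h L
      ≡⟨ cong (∑ 1 K id + E + h (suc K) +_) (partAt-∈ L∈λs) ⟩
    ∑ 1 K id + E + h (suc K) + L
      ∎
    where
    open ≡-Reasoning
    pairs≡ : ∑ 1 K (λ a → h a + h (L ∸ a)) ≡ ∑ 1 K id + E
    pairs≡ = trans (∑-cong 1 K (λ a 1≤a a<1+K → pairWeight≡ 1≤a (≤-pred a<1+K))) (∑-+ 1 K id excess)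

  balance : ∀ {d} → sum λs + d ≡ ∑ 0 (4 + K) id → E + h (suc K) + d ≡ 4 + K
  balance {d} sum+d≡ = +-cancelʳ-≡ (∑ 1 K id + L) _ _ (begin
    E + h (suc K) + d + (∑ 1 K id + L)      ≡⟨ regroupˡ (∑ 1 K id) E (h (suc K)) d K ⟩
    ∑ 1 K id + E + h (suc K) + L + d        ≡⟨ cong (_+ d) (sym sum-λs) ⟩
    sum λs + d                              ≡⟨ sum+d≡ ⟩
    ∑ 1 (3 + K) id                          ≡⟨ cong (λ m → ∑ 1 m id) (+-comm 3 K) ⟩
    ∑ 1 (K + 3) id                          ≡⟨ ∑-split 1 K 3 id ⟩
    ∑ 1 K id + (suc K + (2 + K + (3 + K + 0))) ≡⟨ regroupʳ (∑ 1 K id) K ⟩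
    4 + K + (∑ 1 K id + L)                  ∎)
    where
    open ≡-Reasoning
    regroupˡ : ∀ I E m d K → E + m + d + (I + (2 + (K + K))) ≡ I + E + m + (2 + (K + K)) + d
    regroupˡ = solve-∀
    regroupʳ : ∀ I K → I + (suc K + (2 + K + (3 + K + 0))) ≡ 4 + K + (I + (2 + (K + K)))
    regroupʳ = solve-∀

  1≤K : 1 ≤ K
  1≤K = ≤-trans (s≤s z≤n) 2≤K

  E≤3⇒E≡excessK : E ≤ 3 → E ≡ excess K
  E≤3⇒E≡excessK E≤3 = ∑-single 1 K excess 1≤K (n<1+n K) vanish
    where
    vanish : AllFrom 1 K (λ x → x ≢ K → excess x ≡ 0)
    vanish x 1≤x x<1+K x≢K with excess-cases 1≤x (≤-pred x<1+K)
    ... | inj₁ excess≡0          = excess≡0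
    ... | inj₂ (inj₁ (x≡K , _)) = contradiction x≡K x≢K
    ... | inj₂ (inj₂ 4≤excess)   = contradiction (≤-trans 4≤excess (≤-trans (term≤∑ 1 K excess 1≤x x<1+K) E≤3)) (<⇒≱ (n<1+n 3))

  excessK≢3 : excess K ≢ 3
  excessK≢3 excessK≡3 with excess-cases 1≤K ≤-refl
  ... | inj₁ excessK≡0          = contradiction (trans (sym excessK≡3) excessK≡0) λ ()
  ... | inj₂ (inj₁ (_ , excessK≡2)) = contradiction (trans (sym excessK≡3) excessK≡2) λ ()
  ... | inj₂ (inj₂ 4≤excessK)   = contradiction (subst (4 ≤_) excessK≡3 4≤excessK) (<⇒≱ (n<1+n 3))

  module _ {d : ℕ} (d∉λs : d ∉ λs) (balanced : E + h (suc K) + d ≡ 4 + K) where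

    d≢1+K : d ≢ suc K
    d≢1+K refl = excessK≢3 (trans (sym (E≤3⇒E≡excessK (≤-reflexive E≡3))) E≡3)
      where
      E≡3 : E ≡ 3
      E≡3 = +-cancelʳ-≡ (suc K) E 3 (begin
        E + suc K                ≡⟨ cong (_+ suc K) (sym (+-identityʳ E)) ⟩
        E + 0 + suc K            ≡⟨ cong (λ m → E + m + suc K) (sym (partAt-∉ d∉λs)) ⟩
        E + h (suc K) + suc K    ≡⟨ balanced ⟩
        3 + suc K                ∎)
        where open ≡-Reasoning

    d≢2+K : d ≢ 2 + K
    d≢2+K refl = contradiction (trans (sym mid≡2) (midPart≤2⇒≡0 (≤-reflexive mid≡2))) λ ()
      where
      excessK≡0 : excess K ≡ 0
      excessK≡0 with pairView 1≤K ≤-refl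
      ... | onlySmall K∈λs L∸K∉λs = excess-onlySmall K∈λs L∸K∉λs
      ... | onlyLarge _ L∸K∈λs    = contradiction (subst (_∈ λs) L∸K≡2+K L∸K∈λs) d∉λs
      ... | both _ L∸K∈λs         = contradiction (subst (_∈ λs) L∸K≡2+K L∸K∈λs) d∉λs
      E+mid≡2 : E + h (suc K) ≡ 2
      E+mid≡2 = +-cancelʳ-≡ (2 + K) _ 2 balanced
      E≡0 : E ≡ 0
      E≡0 = trans (E≤3⇒E≡excessK (≤-trans (m≤m+n E _) (≤-trans (≤-reflexive E+mid≡2) (n≤1+n 2)))) excessK≡0
      mid≡2 : h (suc K) ≡ 2
      mid≡2 = trans (cong (_+ h (suc K)) (sym E≡0)) E+mid≡2

    module Concentrated (1≤d : 1 ≤ d) (d≤K : d ≤ K) where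

      d-onlyLarge : L ∸ d ∈ λs × excess d + d + d ≡ L
      d-onlyLarge with pairView 1≤d d≤K
      ... | onlySmall d∈λs _  = contradiction d∈λs d∉λs
      ... | both d∈λs _       = contradiction d∈λs d∉λs
      ... | onlyLarge _ L∸d∈λs = L∸d∈λs , excess-onlyLarge d≤K d∉λs L∸d∈λs

      slack : ∀ {y} → excess d + y ≤ E + h (suc K) → y + K ≤ d + 2
      slack {y} le = +-cancelʳ-≤ (K + 2) (y + K) (d + 2) (begin
        y + K + (K + 2)        ≡⟨ regroup₁ y K ⟩
        L + y                  ≡⟨ cong (_+ y) (sym (proj₂ d-onlyLarge)) ⟩
        excess d + d + d + y   ≡⟨ regroup₂ (excess d) d y ⟩
        excess d + y + d + d   ≤⟨ +-monoˡ-≤ d (+-monoˡ-≤ d le) ⟩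
        E + h (suc K) + d + d  ≡⟨ cong (_+ d) balanced ⟩
        4 + K + d              ≡⟨ regroup₃ K d ⟩
        d + 2 + (K + 2)        ∎)
        where
        open ≤-Reasoning
        regroup₁ : ∀ y K → y + K + (K + 2) ≡ 2 + (K + K) + y
        regroup₁ = solve-∀
        regroup₂ : ∀ e d y → e + d + d + y ≡ e + y + d + d
        regroup₂ = solve-∀
        regroup₃ : ∀ K d → 4 + K + d ≡ d + 2 + (K + 2)
        regroup₃ = solve-∀

      slack≤2 : ∀ {y} → excess d + y ≤ E + h (suc K) → y ≤ 2
      slack≤2 {y} le = +-cancelʳ-≤ K y 2 (≤-trans (slack le) (subst (d + 2 ≤_) (+-comm K 2) (+-monoˡ-≤ 2 d≤K)))

      excessd≤E : excess d ≤ E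
      excessd≤E = term≤∑ 1 K excess 1≤d (s≤s d≤K)

      mid≡0 : h (suc K) ≡ 0
      mid≡0 = midPart≤2⇒≡0 (slack≤2 (+-monoˡ-≤ (h (suc K)) excessd≤E))

      pair≤ : ∀ {x} → 1 ≤ x → x ≤ K → x ≢ d → excess d + excess x ≤ E + h (suc K)
      pair≤ 1≤x x≤K x≢d = ≤-trans (twoTerms≤∑ 1 K excess 1≤d (s≤s d≤K) 1≤x (s≤s x≤K) (x≢d ∘ sym)) (m≤m+n E _)

      excess≡0 : ∀ {x} → 1 ≤ x → x ≤ K → x ≢ d → excess x ≡ 0
      excess≡0 {x} 1≤x x≤K x≢d with excess-cases 1≤x x≤K
      ... | inj₁ excess≡0                 = excess≡0
      ... | inj₂ (inj₁ (refl , excess≡2)) = contradiction (≤-antisym d≤K K≤d) (x≢d ∘ sym)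
        where
        K≤d : K ≤ d
        K≤d = +-cancelʳ-≤ 2 K d (subst (_≤ d + 2) (trans (cong (_+ K) excess≡2) (+-comm 2 K)) (slack (pair≤ 1≤x x≤K x≢d)))
      ... | inj₂ (inj₂ 4≤excess)          = contradiction (≤-trans 4≤excess (slack≤2 (pair≤ 1≤x x≤K x≢d))) λ { (s≤s (s≤s ())) }

      E≡excessd : E ≡ excess d
      E≡excessd = ∑-single 1 K excess 1≤d (s≤s d≤K) (λ x 1≤x x<1+K x≢d → excess≡0 1≤x (≤-pred x<1+K) x≢d)

      d+2≡K : d + 2 ≡ K
      d+2≡K = +-cancelʳ-≡ (2 + K) (d + 2) K (begin
        d + 2 + (2 + K)          ≡⟨ regroup₁ d K ⟩
        4 + K + d                ≡⟨ cong (_+ d) (sym balanced) ⟩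
        E + h (suc K) + d + d    ≡⟨ cong₂ (λ e m → e + m + d + d) E≡excessd mid≡0 ⟩
        excess d + 0 + d + d     ≡⟨ cong (λ e → e + d + d) (+-identityʳ (excess d)) ⟩
        excess d + d + d         ≡⟨ proj₂ d-onlyLarge ⟩
        2 + (K + K)              ≡⟨ regroup₂ K ⟩
        K + (2 + K)              ∎)
        where
        open ≡-Reasoning
        regroup₁ : ∀ d K → d + 2 + (2 + K) ≡ 4 + K + d
        regroup₁ = solve-∀
        regroup₂ : ∀ K → 2 + (K + K) ≡ K + (2 + K)
        regroup₂ = solve-∀

      L∸d≡4+K : L ∸ d ≡ 4 + K
      L∸d≡4+K = trans (cong (_∸ d) L≡d+[4+K]) (m+n∸m≡n d (4 + K))
        where
        regroup : ∀ K d → 2 + (K + (d + 2)) ≡ d + (4 + K)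
        regroup = solve-∀
        L≡d+[4+K] : L ≡ d + (4 + K)
        L≡d+[4+K] = trans (cong (λ k → 2 + (K + k)) (sym d+2≡K)) (regroup K d)

      extremal⇒∈ : ∀ {x} → ExtremalPart K d x → x ∈ λs
      extremal⇒∈ (inj₁ (1≤x , x≤K , x≢d)) = proj₁ (excess≡0⇒onlySmall 1≤x x≤K (excess≡0 1≤x x≤K x≢d))
      extremal⇒∈ (inj₂ (inj₁ refl))       = subst (_∈ λs) L∸d≡4+K (proj₁ d-onlyLarge)
      extremal⇒∈ (inj₂ (inj₂ refl))       = L∈λs

      ∈⇒extremal : All (0 <_) λs → ∀ {x} → x ∈ λs → ExtremalPart K d x
      ∈⇒extremal positive {x} x∈λs with x ≤? K
      ... | yes x≤K = inj₁ (All.lookup positive x∈λs , x≤K , λ x≡d → d∉λs (subst (_∈ λs) x≡d x∈λs))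
      ... | no x≰K with x ≟ suc K | x ≟ L
      ...   | yes refl | _        = contradiction (trans (sym (partAt-∈ x∈λs)) mid≡0) λ ()
      ...   | no _     | yes x≡L  = inj₂ (inj₂ x≡L)
      ...   | no x≢1+K | no x≢L   = mirrored (L ∸ x ≟ d)
        where
        x≤L : x ≤ L
        x≤L = All.lookup parts≤L x∈λs
        1≤L∸x : 1 ≤ L ∸ x
        1≤L∸x = m<n⇒0<n∸m (≤∧≢⇒< x≤L x≢L)
        L∸x≤K : L ∸ x ≤ K
        L∸x≤K = subst (L ∸ x ≤_) (m+n∸m≡n (2 + K) K) (∸-monoʳ-≤ L (≤∧≢⇒< (≰⇒> x≰K) (x≢1+K ∘ sym)))
        L∸[L∸x]≡x : L ∸ (L ∸ x) ≡ x
        L∸[L∸x]≡x = m∸[m∸n]≡n x≤L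
        mirrored : Dec (L ∸ x ≡ d) → ExtremalPart K d x
        mirrored (yes L∸x≡d) = inj₂ (inj₁ (trans (sym L∸[L∸x]≡x) (trans (cong (L ∸_) L∸x≡d) L∸d≡4+K)))
        mirrored (no L∸x≢d)  = contradiction (subst (_∈ λs) (sym L∸[L∸x]≡x) x∈λs)
          (proj₂ (excess≡0⇒onlySmall 1≤L∸x L∸x≤K (excess≡0 1≤L∸x L∸x≤K L∸x≢d)))

  characterization : All (0 <_) λs → ∀ {d} → 1 ≤ d → d ≤ 2 + K → d ∉ λs → sum λs + d ≡ ∑ 0 (4 + K) id →
    d + 2 ≡ K × (∀ x → x ∈ λs ⇔ ExtremalPart K d x)
  characterization positive {d} 1≤d d≤2+K d∉λs sum+d≡ with d ≤? K
  ... | yes d≤K = d+2≡K , λ x → mk⇔ (∈⇒extremal positive) extremal⇒∈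
    where open Concentrated d∉λs (balance sum+d≡) 1≤d d≤K
  ... | no d≰K with m≤n⇒m<n∨m≡n d≤2+K
  ...   | inj₂ d≡2+K = contradiction d≡2+K (d≢2+K d∉λs (balance sum+d≡))
  ...   | inj₁ d<2+K = contradiction (≤-antisym (≤-pred d<2+K) (≰⇒> d≰K)) (d≢1+K d∉λs (balance sum+d≡))

T+d≡∑ : ∀ n d → d ≤ n → T n d + d ≡ ∑ 0 (suc n) id
T+d≡∑ n d d≤n = trans (cong (λ t → t ∸ d + d) half≡∑) (m∸n+n≡m (≤-trans d≤n (term≤∑ 0 (suc n) id z≤n ≤-refl)))
  where
  half≡∑ : n * (n + 1) / 2 ≡ ∑ 0 (suc n) id
  half≡∑ = trans (cong (_/ 2) (sym (∑-id*2 n))) (m*n/n≡m (∑ 0 (suc n) id) 2)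

2[3+K]∸4≡2+[K+K] : ∀ K → 2 * (3 + K) ∸ 4 ≡ 2 + (K + K)
2[3+K]∸4≡2+[K+K] K = cong (_∸ 4) (double K)
  where
  double : ∀ K → 2 * (3 + K) ≡ 4 + (2 + (K + K))
  double = solve-∀

proposition2p10 : (n d : ℕ) → 11 ≤ n → 1 ≤ d → d ≤ n ∸ 1 →
    (λs : List ℕ) → Cond n d λs →
    (d ≡ n ∸ 5) × (∀ (μ : List ℕ) → Cond n d μ → μ ≡ λs)
proposition2p10 .(3 + K) d (s≤s (s≤s (s≤s {n = K} 8≤K))) 1≤d d≤2+K λs condλ =
  sym (trans (cong (_∸ 2) (sym (proj₁ (characterize λs condλ)))) (m+n∸n≡m d 2)) ,
  λ μ condμ → increasing-ext (increasing condμ) (increasing condλ)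
    (λ z → from (proj₂ (characterize λs condλ) z) ∘ to (proj₂ (characterize μ condμ) z))
    (λ z → from (proj₂ (characterize μ condμ) z) ∘ to (proj₂ (characterize λs condλ) z))
  where
  open Equivalence
  increasing : ∀ {μ} → Cond (3 + K) d μ → Linked _<_ μ
  increasing (((partition , _) , _) , _) = DistinctPartition.increasing partition
  characterize : ∀ μ → Cond (3 + K) d μ → d + 2 ≡ K × (∀ x → x ∈ μ ⇔ ExtremalPart K d x)
  characterize μ (((partition , unrefinable) , _) , d∉μ , largest≡) =
    LargestPart2K+2.characterization K (≤-trans (s≤s (s≤s z≤n)) 8≤K) (DistinctPartition.increasing partition) unrefinable
      (trans largest≡ (2[3+K]∸4≡2+[K+K] K)) (DistinctPartition.positive partition) 1≤d d≤2+K d∉μ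
      (trans (cong (_+ d) (DistinctPartition.sums partition)) (T+d≡∑ (3 + K) d (≤-trans d≤2+K (n≤1+n _))))
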